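{- Let $g$ be a convex geometry on a finite set $I$. For every set composition $F$ of $I$, $f^{\varphi'}_F(g)=2^{\mathrm{ex}(g,F)}$ if $F$ corresponds to a flag of convex sets of $g$ (i.e. all initial unions of $F$ are convex), and $f^{\varphi'}_F(g)=0$ otherwise.
   Context: A convex geometry on finite $I$ is $g:2^I\to2^I$ with $A\subseteq g(A)$, $g(g(A))=g(A)$, monotone, $g(\emptyset)=\emptyset$, and anti-exchange (if $a\ne b$, $a,b\notin g(A)$, $a\in g(A\cup\{b\})$ then $b\notin g(A\cup\{a\})$). Convex sets: $g(K)=K$. For convex $A\subseteq B$, $g_{A:B}(X)=g(A\cup X)\cap(B\setminus A)$ on $B\setminus A$; $g|_S=g_{\emptyset:S}$, $g/_S=g_{S:I}$. For a convex geometry $h$ on $J$, $\mathrm{Ex}(h)=\{x\in J: h(J\setminus\{x\})=J\setminus\{x\}\}$. Characters (field of characteristic $\ne2$): $\eta_I(g)=1$; $\zeta_I(g)=1$ if $g$ is discrete ($g(X)=X$ for all $X$) else $0$; convolution $(\psi*\psi')_I(g)=\sum_{S\sqcup T=I,\ S\text{ convex}}\psi_S(g|_S)\psi'_T(g/_S)$; $\varphi'=\eta*\zeta$. For a set composition $F=(F_1,\dots,F_k)$ with $A_i=F_1\cup\dots\cup F_i$, $A_0=\emptyset$: $f^{\psi}_F(g)=\prod_i\psi_{F_i}(g_{A_{i-1}:A_i})$ if all $A_i$ are convex, and $0$ otherwise. $\mathrm{ex}(g,F)=\sum_{i=1}^k|\mathrm{Ex}(g_{A_{i-1}:A_i})|$.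 -}

module Defs where

open import Data.Nat using (ℕ; zero; suc; _+_; _*_)
open import Data.Bool using (Bool; true; false; if_then_else_)
open import Data.Fin using (Fin)
open import Data.Fin.Subset using (Subset; _∪_; _∩_; _─_; _-_; ⁅_⁆; ⊥; ⊤; _∈_; _∉_; _⊆_; Nonempty; ⋃)
open import Data.Fin.Subset.Properties using (_⊆?_; _∈?_)
open import Data.Vec using (Vec; []; _∷_; count; allFin)
open import Data.Vec.Properties using (≡-dec)
open import Data.List using (List; []; _∷_; _++_; map)
open import Data.Nat.ListAction using (sum)
open import Data.List.Relation.Unary.All using (All)
open import Data.List.Relation.Unary.AllPairs using (AllPairs)
open import Data.Product using (_×_; _,_)
open import Data.Unit using () renaming (⊤ to Unit; tt to ∗)
open import Relation.Nullary using (Dec; yes; no; ¬_; does)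
open import Relation.Nullary.Decidable using (_×-dec_)
open import Relation.Binary.PropositionalEquality using (_≡_; _≢_)
import Data.Bool.Properties as BoolP

-- Throughout, the finite ground set I is  Fin n.  A "geometry on ground set J ⊆ Fin n" is an
-- operator h, only ever evaluated on subsets of J (this lets minors
-- g_{A:B}, which live on B \ A, be represented without re-indexing).

Op : ℕ → Set
Op n = Subset n → Subset n

_≟ˢ_ : ∀ {n} (X Y : Subset n) → Dec (X ≡ Y)
_≟ˢ_ = ≡-dec BoolP._≟_

record IsConvexGeometry {n : ℕ} (g : Op n) : Set where
  field
    extensive   : ∀ A → A ⊆ g A
    idempotent  : ∀ A → g (g A) ≡ g A
    monotone    : ∀ A B → A ⊆ B → g A ⊆ g B
    empty       : g ⊥ ≡ ⊥
    antiExchange : ∀ A a b → a ≢ b → a ∉ g A → b ∉ g A →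
                   a ∈ g (A ∪ ⁅ b ⁆) → b ∉ g (A ∪ ⁅ a ⁆)

minor : ∀ {n} → Op n → Subset n → Subset n → Op n
minor g A B X = g (A ∪ X) ∩ (B ─ A)

allSubsets : ∀ n → List (Subset n)
allSubsets zero    = [] ∷ []
allSubsets (suc n) = map (false ∷_) (allSubsets n) ++ map (true ∷_) (allSubsets n)

-- A character: a value for every geometry (ground set J, operator h).
-- All characters involved here take values 0/1 and their combinations,
-- so we compute in ℕ.
Character : ℕ → Set
Character n = Subset n → Op n → ℕ

η : ∀ {n} → Character n
η J h = 1

Discrete : ∀ {n} → Subset n → Op n → Set
Discrete {n} J h = All (λ X → X ⊆ J → h X ≡ X) (allSubsets n)

discrete? : ∀ {n} (J : Subset n) (h : Op n) → Dec (Discrete J h)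
discrete? {n} J h = Data.List.Relation.Unary.All.all? (λ X → dec X) (allSubsets n)
  where
  open import Relation.Nullary.Decidable using (_→-dec_)
  dec : ∀ X → Dec (X ⊆ J → h X ≡ X)
  dec X = (X ⊆? J) →-dec (h X ≟ˢ X)

ζ : ∀ {n} → Character n
ζ J h = if does (discrete? J h) then 1 else 0

convexIn? : ∀ {n} (J : Subset n) (h : Op n) (S : Subset n) → Dec ((S ⊆ J) × (minor h ⊥ J S ≡ S))
convexIn? J h S = (S ⊆? J) ×-dec (minor h ⊥ J S ≟ˢ S)

-- convolution (ψ * ψ')_J(h) = Σ_{S ⊔ T = J, S convex} ψ_S(h|_S) ψ'_T(h/_S),
-- with h|_S = h_{∅:S} and h/_S = h_{S:J}
_⋆_ : ∀ {n} → Character n → Character n → Character n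
(ψ ⋆ ψ') J h = sum (map term (allSubsets _))
  where
  term : Subset _ → ℕ
  term S = if does (convexIn? J h S)
           then ψ S (minor h ⊥ S) * ψ' (J ─ S) (minor h S J)
           else 0

φ' : ∀ {n} → Character n
φ' = η ⋆ ζ

IsSetComposition : ∀ {n} → List (Subset n) → Set
IsSetComposition F = All Nonempty F × AllPairs (λ X Y → X ∩ Y ≡ ⊥) F × ⋃ F ≡ ⊤

PrefixesConvexFrom : ∀ {n} → Op n → Subset n → List (Subset n) → Set
PrefixesConvexFrom g A []      = Unit
PrefixesConvexFrom g A (B ∷ F) = (g (A ∪ B) ≡ A ∪ B) × PrefixesConvexFrom g (A ∪ B) F

prefixesConvexFrom? : ∀ {n} (g : Op n) A F → Dec (PrefixesConvexFrom g A F)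
prefixesConvexFrom? g A []      = yes ∗
prefixesConvexFrom? g A (B ∷ F) = (g (A ∪ B) ≟ˢ (A ∪ B)) ×-dec prefixesConvexFrom? g (A ∪ B) F

IsFlag : ∀ {n} → Op n → List (Subset n) → Set
IsFlag g F = PrefixesConvexFrom g ⊥ F

prodFrom : ∀ {n} → Character n → Op n → Subset n → List (Subset n) → ℕ
prodFrom ψ g A []      = 1
prodFrom ψ g A (B ∷ F) = ψ B (minor g A (A ∪ B)) * prodFrom ψ g (A ∪ B) F

f : ∀ {n} → Character n → List (Subset n) → Op n → ℕ
f ψ F g = if does (prefixesConvexFrom? g ⊥ F) then prodFrom ψ g ⊥ F else 0

numEx : ∀ {n} → Subset n → Op n → ℕ
numEx {n} J h = count (λ x → (x ∈? J) ×-dec (minor h ⊥ J (J - x) ≟ˢ (J - x))) (allFin n)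

exFrom : ∀ {n} → Op n → Subset n → List (Subset n) → ℕ
exFrom g A []      = 0
exFrom g A (B ∷ F) = numEx B (minor g A (A ∪ B)) + exFrom g (A ∪ B) F

ex : ∀ {n} → Op n → List (Subset n) → ℕ
ex g F = exFrom g ⊥ F

-- For a single block J with operator h, φ'_J(h) = (η * ζ)_J(h) counts the convex S ⊆ J whose
-- contraction h/S is discrete. These are exactly the S containing every non-extreme point of J:
-- if all of J ∖ S is extreme, no y ∈ J ∖ T lies in the closure of a T with S ⊆ T ⊆ J, since
-- T ⊆ J − y and J − y is closed; conversely, if h/S is discrete then for x ∈ J ∖ S the set
-- J − x = S ∪ ((J ∖ S) − x) is closed. Hence φ'_J(h) = 2^|Ex(h)|, and f^φ'_F(g) multiplies these
-- over the blocks of F.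

module Submission where

open import Defs
open import Data.Bool using (true; false; if_then_else_; _∧_)
open import Data.Bool.Properties using (∧-zeroʳ)
open import Data.Nat using (ℕ; suc; _^_; _+_; _*_)
open import Data.Nat.Properties using (+-identityʳ; ^-distribˡ-+-*)
open import Data.List using (List; []; _∷_; _++_; map)
open import Data.List.Properties using (map-++; map-∘; map-cong)
open import Data.List.Relation.Unary.All as All using (All; []; _∷_)
open import Data.List.Relation.Unary.AllPairs using (AllPairs; []; _∷_)
open import Data.List.Relation.Unary.Any using (here)
open import Data.List.Membership.Propositional as List using ()
open import Data.List.Membership.Propositional.Properties using (∈-++⁺ˡ; ∈-++⁺ʳ; ∈-map⁺)
open import Data.Nat.ListAction using (sum)
open import Data.Nat.ListAction.Properties using (sum-++)
open import Data.Fin using (Fin)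
open import Data.Fin.Subset
  using (Subset; outside; inside; _∈_; _∉_; _⊆_; _∪_; _∩_; _─_; _-_; ⁅_⁆; ⊥; ∣_∣)
open import Data.Fin.Subset.Properties
  using (_⊆?_; _∈?_; drop-∷-⊆; ⊆-antisym; p─q⊆p; p─⊥≡p; ∪-identityˡ; ∩-distribʳ-∪; ∩-zeroˡ;
         x∈p∩q⁺; x∈p∩q⁻; x∈p∪q⁺; x∈p∪q⁻; p⊆p∪q; q⊆p∪q; ∉⊥; x∈p∧x∉q⇒x∈p─q; x∈p∧x≢y⇒x∈p-y; x∉⁅y⁆⇒x≢y)
open import Data.Vec using (Vec; _∷_; []; here; there; tabulate; count; allFin)
import Data.Vec as Vec
open import Data.Vec.Properties using (lookup∘tabulate; tabulate-allFin; []=⇒lookup; lookup⇒[]=)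
open import Data.Product using (_×_; _,_; proj₁; proj₂)
open import Data.Sum using (inj₁; inj₂; [_,_]′)
open import Function using (_∘_; _$_; id)
open import Function.Bundles using (_⇔_; mk⇔)
open import Level using (Level)
open import Relation.Nullary using (yes; no; does; ¬_; _×-dec_; contradiction)
open import Relation.Nullary.Decidable using (does-⇔; dec-true; dec-false)
open import Relation.Unary using (Pred; Decidable)
open import Relation.Binary.PropositionalEquality
  using (_≡_; _≢_; refl; sym; trans; cong; cong₂; subst; module ≡-Reasoning)

private variable
  ℓ : Level
  n : ℕ
  x y : Fin n
  p q r A B S T X Y Z : Subset n

x∈p─q⇒x∉q : x ∈ p ─ q → x ∉ q
x∈p─q⇒x∉q {p = inside ∷ p} {q = outside ∷ q} here ()
x∈p─q⇒x∉q {p = _ ∷ p}      {q = _ ∷ q}       (there x∈p─q) (there x∈q) = x∈p─q⇒x∉q x∈p─q x∈q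

x∈p-y⇒x≢y : x ∈ p - y → x ≢ y
x∈p-y⇒x≢y = x∉⁅y⁆⇒x≢y ∘ x∈p─q⇒x∉q

p─q⊆r⇒p─r⊆q : p ─ q ⊆ r → p ─ r ⊆ q
p─q⊆r⇒p─r⊆q {p = p} {q} {r} p─q⊆r {x} x∈p─r with x ∈? q
... | yes x∈q = x∈q
... | no  x∉q = contradiction (p─q⊆r (x∈p∧x∉q⇒x∈p─q (p─q⊆p p r x∈p─r) x∉q)) (x∈p─q⇒x∉q x∈p─r)

∪-monoʳ-⊆ : p ⊆ q → r ∪ p ⊆ r ∪ q
∪-monoʳ-⊆ {r = r} p⊆q x∈r∪p with x∈p∪q⁻ r _ x∈r∪p
... | inj₁ x∈r = x∈p∪q⁺ (inj₁ x∈r)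
... | inj₂ x∈p = x∈p∪q⁺ (inj₂ (p⊆q x∈p))

Disjoint : Subset n → Subset n → Set
Disjoint p q = p ∩ q ≡ ⊥

disjoint⇒∉ : Disjoint p q → x ∈ q → x ∉ p
disjoint⇒∉ p∩q≡⊥ x∈q x∈p = ∉⊥ (subst (_ ∈_) p∩q≡⊥ (x∈p∩q⁺ (x∈p , x∈q)))

∪-disjoint : Disjoint p r → Disjoint q r → Disjoint (p ∪ q) r
∪-disjoint {p = p} {r} {q} p∩r≡⊥ q∩r≡⊥ = begin
  (p ∪ q) ∩ r        ≡⟨ ∩-distribʳ-∪ r p q ⟩
  (p ∩ r) ∪ (q ∩ r)  ≡⟨ cong₂ _∪_ p∩r≡⊥ q∩r≡⊥ ⟩
  ⊥ ∪ ⊥              ≡⟨ ∪-identityˡ ⊥ ⟩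
  ⊥                  ∎
  where open ≡-Reasoning

toSubset : {P : Pred (Fin n) ℓ} → Decidable P → Subset n
toSubset P? = tabulate (does ∘ P?)

module _ {P : Pred (Fin n) ℓ} (P? : Decidable P) where

  ∈-toSubset⁻ : x ∈ toSubset P? → P x
  ∈-toSubset⁻ {x = x} x∈ with P? x | trans (sym (lookup∘tabulate (does ∘ P?) x)) ([]=⇒lookup x∈)
  ... | yes px | _  = px
  ... | no  _  | ()

  ∈-toSubset⁺ : P x → x ∈ toSubset P?
  ∈-toSubset⁺ {x = x} px = lookup⇒[]= x _ (trans (lookup∘tabulate (does ∘ P?) x) (dec-true (P? x) px))

  ∣toSubset∣ : ∣ toSubset P? ∣ ≡ count P? (allFin n)
  ∣toSubset∣ = trans (cong ∣_∣ (tabulate-allFin (does ∘ P?))) (∣map-does∣ (allFin n))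
    where
    ∣map-does∣ : ∀ {m} (xs : Vec (Fin n) m) → ∣ Vec.map (does ∘ P?) xs ∣ ≡ count P? xs
    ∣map-does∣ []       = refl
    ∣map-does∣ (x ∷ xs) with does (P? x)
    ... | true  = cong suc (∣map-does∣ xs)
    ... | false = ∣map-does∣ xs

∈-allSubsets : ∀ (X : Subset n) → X List.∈ allSubsets n
∈-allSubsets []           = here refl
∈-allSubsets (outside ∷ X) = ∈-++⁺ˡ (∈-map⁺ (outside ∷_) (∈-allSubsets X))
∈-allSubsets (inside ∷ X)  = ∈-++⁺ʳ (map (outside ∷_) (allSubsets _)) (∈-map⁺ (inside ∷_) (∈-allSubsets X))

#subsets : {P : Pred (Subset n) ℓ} → Decidable P → ℕ
#subsets P? = sum (map (λ S → if does (P? S) then 1 else 0) (allSubsets _))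

#subsets-cong : {P Q : Pred (Subset n) ℓ} (P? : Decidable P) (Q? : Decidable Q) →
  (∀ S → does (P? S) ≡ does (Q? S)) → #subsets P? ≡ #subsets Q?
#subsets-cong P? Q? eq = cong sum (map-cong (λ S → cong (if_then 1 else 0) (eq S)) (allSubsets _))

#subsets-none : {P : Pred (Subset n) ℓ} (P? : Decidable P) → (∀ S → does (P? S) ≡ false) → #subsets P? ≡ 0
#subsets-none P? never = sumZeros (allSubsets _)
  where
  sumZeros : ∀ Ss → sum (map (λ S → if does (P? S) then 1 else 0) Ss) ≡ 0
  sumZeros []       = refl
  sumZeros (S ∷ Ss) rewrite never S = sumZeros Ss

#subsets-∷ : {P : Pred (Subset (suc n)) ℓ} (P? : Decidable P) →
  #subsets P? ≡ #subsets (P? ∘ (outside ∷_)) + #subsets (P? ∘ (inside ∷_))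
#subsets-∷ {n = n} P? = begin
  sum (map ind (map (outside ∷_) Ss ++ map (inside ∷_) Ss))
    ≡⟨ cong sum (map-++ ind (map (outside ∷_) Ss) _) ⟩
  sum (map ind (map (outside ∷_) Ss) ++ map ind (map (inside ∷_) Ss))
    ≡⟨ sum-++ (map ind (map (outside ∷_) Ss)) _ ⟩
  sum (map ind (map (outside ∷_) Ss)) + sum (map ind (map (inside ∷_) Ss))
    ≡⟨ sym (cong₂ _+_ (cong sum (map-∘ Ss)) (cong sum (map-∘ Ss))) ⟩
  #subsets (P? ∘ (outside ∷_)) + #subsets (P? ∘ (inside ∷_)) ∎
  where
  open ≡-Reasoning
  Ss = allSubsets n
  ind = λ S → if does (P? S) then 1 else 0

Between : Subset n → Subset n → Pred (Subset n) _
Between L U S = L ⊆ S × S ⊆ U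

between? : (L U : Subset n) → Decidable (Between L U)
between? L U S = (L ⊆? S) ×-dec (S ⊆? U)

#subsets-between : (U E : Subset n) → E ⊆ U → #subsets (between? (U ─ E) U) ≡ 2 ^ ∣ E ∣
#subsets-between []            []            _   = refl
#subsets-between (outside ∷ U) (outside ∷ E) E⊆U = begin
  #subsets between               ≡⟨ #subsets-∷ between ⟩
  #subsets (between ∘ (outside ∷_)) + #subsets (between ∘ (inside ∷_))
    ≡⟨ cong₂ _+_ (#subsets-between U E (drop-∷-⊆ E⊆U))
                 (#subsets-none (between ∘ (inside ∷_)) (λ S → ∧-zeroʳ (does (U ─ E ⊆? S)))) ⟩
  2 ^ ∣ E ∣ + 0                  ≡⟨ +-identityʳ _ ⟩
  2 ^ ∣ E ∣                      ∎
  where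
  open ≡-Reasoning
  between = between? (outside ∷ (U ─ E)) (outside ∷ U)
#subsets-between (inside ∷ U)  (outside ∷ E) E⊆U =
  trans (#subsets-∷ between) $
  cong₂ _+_ (#subsets-none (between ∘ (outside ∷_)) (λ S → refl)) (#subsets-between U E (drop-∷-⊆ E⊆U))
  where between = between? (inside ∷ (U ─ E)) (inside ∷ U)
#subsets-between (inside ∷ U)  (inside ∷ E)  E⊆U =
  trans (#subsets-∷ (between? (outside ∷ (U ─ E)) (inside ∷ U))) $
  cong₂ _+_ IH (trans IH (sym (+-identityʳ _)))
  where IH = #subsets-between U E (drop-∷-⊆ E⊆U)
#subsets-between (outside ∷ U) (inside ∷ E)  E⊆U with () ← E⊆U here

module _ {J : Subset n} {h : Op n} where

  discrete⁺ : (∀ X → X ⊆ J → h X ≡ X) → Discrete J h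
  discrete⁺ h≡id = All.tabulate (λ {X} _ → h≡id X)

  discrete⁻ : Discrete J h → ∀ X → X ⊆ J → h X ≡ X
  discrete⁻ disc X = All.lookup disc (∈-allSubsets X)

minor-⊥ : (h : Op n) (J T : Subset n) → minor h ⊥ J T ≡ h T ∩ J
minor-⊥ h J T rewrite ∪-identityˡ T | p─⊥≡p J = refl

φ'≡#convex-discrete : (J : Subset n) (h : Op n) →
  φ' J h ≡ #subsets (λ S → convexIn? J h S ×-dec discrete? (J ─ S) (minor h S J))
φ'≡#convex-discrete J h =
  cong sum (map-cong (λ S → if-∧ (does (convexIn? J h S)) (does (discrete? (J ─ S) (minor h S J))))
                     (allSubsets _))
  where
  if-∧ : ∀ a b → (if a then 1 * (if b then 1 else 0) else 0) ≡ (if a ∧ b then 1 else 0)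
  if-∧ true  true  = refl
  if-∧ true  false = refl
  if-∧ false _     = refl

IsExtreme : Subset n → Op n → Pred (Fin n) _
IsExtreme J h x = x ∈ J × minor h ⊥ J (J - x) ≡ J - x

isExtreme? : (J : Subset n) (h : Op n) → Decidable (IsExtreme J h)
isExtreme? J h x = (x ∈? J) ×-dec (minor h ⊥ J (J - x) ≟ˢ (J - x))

extremePoints : Subset n → Op n → Subset n
extremePoints J h = toSubset (isExtreme? J h)

module _ {J : Subset n} {h : Op n}
         (extensive : ∀ Y → Y ⊆ J → Y ⊆ h Y)
         (monotone  : ∀ Y Z → Y ⊆ Z → h Y ⊆ h Z) where

  private
    Ex = extremePoints J h

  closed-if-complement-extreme : J ─ S ⊆ Ex → S ⊆ T → T ⊆ J → h T ∩ J ⊆ T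
  closed-if-complement-extreme {S = S} {T} J─S⊆Ex S⊆T T⊆J {y} y∈hT∩J with y ∈? T
  ... | yes y∈T = y∈T
  ... | no  y∉T = contradiction refl (x∈p-y⇒x≢y y∈J-y)
    where
    y∈hT = proj₁ (x∈p∩q⁻ (h T) J y∈hT∩J)
    y∈J  = proj₂ (x∈p∩q⁻ (h T) J y∈hT∩J)
    y-extreme : minor h ⊥ J (J - y) ≡ J - y
    y-extreme = proj₂ (∈-toSubset⁻ (isExtreme? J h) (J─S⊆Ex (x∈p∧x∉q⇒x∈p─q y∈J (y∉T ∘ S⊆T))))
    T⊆J-y : T ⊆ J - y
    T⊆J-y z∈T = x∈p∧x≢y⇒x∈p-y (T⊆J z∈T) (λ { refl → y∉T z∈T })
    y∈J-y : y ∈ J - y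
    y∈J-y = subst (y ∈_) (trans (sym (minor-⊥ h J (J - y))) y-extreme)
                  (x∈p∩q⁺ (monotone T (J - y) T⊆J-y y∈hT , y∈J))

  convex-if-complement-extreme : S ⊆ J → J ─ S ⊆ Ex → minor h ⊥ J S ≡ S
  convex-if-complement-extreme {S = S} S⊆J J─S⊆Ex = trans (minor-⊥ h J S) $ ⊆-antisym
    (closed-if-complement-extreme J─S⊆Ex id S⊆J)
    (λ x∈S → x∈p∩q⁺ (extensive S S⊆J x∈S , S⊆J x∈S))

  discrete-if-complement-extreme : S ⊆ J → J ─ S ⊆ Ex → Discrete (J ─ S) (minor h S J)
  discrete-if-complement-extreme {S = S} S⊆J J─S⊆Ex = discrete⁺ λ X X⊆J─S → ⊆-antisym
    (λ y∈ → let y∈h[S∪X] , y∈J─S = x∈p∩q⁻ (h (S ∪ X)) (J ─ S) y∈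
                y∈S∪X = closed-if-complement-extreme J─S⊆Ex (p⊆p∪q X) (S∪X⊆J X⊆J─S)
                          (x∈p∩q⁺ (y∈h[S∪X] , p─q⊆p J S y∈J─S))
            in  [ (λ y∈S → contradiction y∈S (x∈p─q⇒x∉q y∈J─S)) , id ]′ (x∈p∪q⁻ S X y∈S∪X))
    (λ y∈X → x∈p∩q⁺ (extensive (S ∪ X) (S∪X⊆J X⊆J─S) (q⊆p∪q S X y∈X) , X⊆J─S y∈X))
    where
    S∪X⊆J : X ⊆ J ─ S → S ∪ X ⊆ J
    S∪X⊆J {X} X⊆J─S y∈S∪X = [ S⊆J , p─q⊆p J S ∘ X⊆J─S ]′ (x∈p∪q⁻ S X y∈S∪X)

  complement-extreme-if-discrete : S ⊆ J → Discrete (J ─ S) (minor h S J) → J ─ S ⊆ Ex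
  complement-extreme-if-discrete {S = S} S⊆J disc {x} x∈J─S =
    ∈-toSubset⁺ (isExtreme? J h) (x∈J , trans (minor-⊥ h J (J - x)) (⊆-antisym ⊆J-x ⊇J-x))
    where
    x∈J = p─q⊆p J S x∈J─S
    R = (J ─ S) - x
    R⊆J─S : R ⊆ J ─ S
    R⊆J─S = p─q⊆p (J ─ S) ⁅ x ⁆
    J-x⊆S∪R : J - x ⊆ S ∪ R
    J-x⊆S∪R {y} y∈J-x with y ∈? S
    ... | yes y∈S = x∈p∪q⁺ (inj₁ y∈S)
    ... | no  y∉S = x∈p∪q⁺ (inj₂ (x∈p∧x≢y⇒x∈p-y y∈J─S (x∈p-y⇒x≢y y∈J-x)))
      where y∈J─S = x∈p∧x∉q⇒x∈p─q (p─q⊆p J ⁅ x ⁆ y∈J-x) y∉S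
    ⊆J-x : h (J - x) ∩ J ⊆ J - x
    ⊆J-x {y} y∈ with x∈p∩q⁻ (h (J - x)) J y∈ | y ∈? S
    ... | _ , y∈J | yes y∈S = x∈p∧x≢y⇒x∈p-y y∈J (λ { refl → x∈p─q⇒x∉q x∈J─S y∈S })
    ... | y∈h[J-x] , y∈J | no y∉S = x∈p∧x≢y⇒x∈p-y y∈J (x∈p-y⇒x≢y y∈R)
      where
      y∈R : y ∈ R
      y∈R = subst (y ∈_) (discrete⁻ disc R R⊆J─S)
                  (x∈p∩q⁺ (monotone (J - x) (S ∪ R) J-x⊆S∪R y∈h[J-x] , x∈p∧x∉q⇒x∈p─q y∈J y∉S))
    ⊇J-x : J - x ⊆ h (J - x) ∩ J
    ⊇J-x y∈J-x = x∈p∩q⁺ (extensive (J - x) (p─q⊆p J ⁅ x ⁆) y∈J-x , p─q⊆p J ⁅ x ⁆ y∈J-x)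

  convex-discrete⇔between :
    (((S ⊆ J) × (minor h ⊥ J S ≡ S)) × Discrete (J ─ S) (minor h S J)) ⇔ Between (J ─ Ex) J S
  convex-discrete⇔between = mk⇔
    (λ ((S⊆J , _) , disc) → p─q⊆r⇒p─r⊆q (complement-extreme-if-discrete S⊆J disc) , S⊆J)
    (λ (J─Ex⊆S , S⊆J) → let J─S⊆Ex = p─q⊆r⇒p─r⊆q J─Ex⊆S in
      (S⊆J , convex-if-complement-extreme S⊆J J─S⊆Ex) , discrete-if-complement-extreme S⊆J J─S⊆Ex)

  φ'≡2^numEx : φ' J h ≡ 2 ^ numEx J h
  φ'≡2^numEx = begin
    φ' J h
      ≡⟨ φ'≡#convex-discrete J h ⟩
    #subsets (λ S → convexIn? J h S ×-dec discrete? (J ─ S) (minor h S J))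
      ≡⟨ #subsets-cong convex-discrete? (between? (J ─ Ex) J)
                       (λ S → does-⇔ convex-discrete⇔between (convex-discrete? S) (between? (J ─ Ex) J S)) ⟩
    #subsets (between? (J ─ Ex) J)
      ≡⟨ #subsets-between J Ex (proj₁ ∘ ∈-toSubset⁻ (isExtreme? J h)) ⟩
    2 ^ ∣ Ex ∣
      ≡⟨ cong (2 ^_) (∣toSubset∣ (isExtreme? J h)) ⟩
    2 ^ numEx J h ∎
    where
    open ≡-Reasoning
    convex-discrete? = λ S → convexIn? J h S ×-dec discrete? (J ─ S) (minor h S J)

module _ {g : Op n}
         (extensive : ∀ A → A ⊆ g A)
         (monotone  : ∀ A B → A ⊆ B → g A ⊆ g B) where

  minor-extensive : Disjoint A B → Y ⊆ B → Y ⊆ minor g A (A ∪ B) Y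
  minor-extensive {A = A} {B} {Y} A∩B≡⊥ Y⊆B x∈Y =
    x∈p∩q⁺ (extensive (A ∪ Y) (q⊆p∪q A Y x∈Y) ,
            x∈p∧x∉q⇒x∈p─q (q⊆p∪q A B (Y⊆B x∈Y)) (disjoint⇒∉ A∩B≡⊥ (Y⊆B x∈Y)))

  minor-monotone : Y ⊆ Z → minor g A B Y ⊆ minor g A B Z
  minor-monotone {Y = Y} {Z} {A} {B} Y⊆Z x∈ =
    let x∈g[A∪Y] , x∈B─A = x∈p∩q⁻ (g (A ∪ Y)) (B ─ A) x∈
    in  x∈p∩q⁺ (monotone (A ∪ Y) (A ∪ Z) (∪-monoʳ-⊆ Y⊆Z) x∈g[A∪Y] , x∈B─A)

  prodFrom-φ' : (F : List (Subset n)) → All (Disjoint A) F → AllPairs Disjoint F →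
    prodFrom φ' g A F ≡ 2 ^ exFrom g A F
  prodFrom-φ' []      _ _ = refl
  prodFrom-φ' {A = A} (B ∷ F) (A∩B≡⊥ ∷ A∩F≡⊥) (B∩F≡⊥ ∷ F-disjoint) = begin
    φ' B (minor g A (A ∪ B)) * prodFrom φ' g (A ∪ B) F
      ≡⟨ cong₂ _*_ (φ'≡2^numEx (λ Y → minor-extensive A∩B≡⊥) (λ Y Z → minor-monotone))
                   (prodFrom-φ' F (All.zipWith (λ (p , q) → ∪-disjoint p q) (A∩F≡⊥ , B∩F≡⊥)) F-disjoint) ⟩
    2 ^ numEx B (minor g A (A ∪ B)) * 2 ^ exFrom g (A ∪ B) F
      ≡⟨ sym (^-distribˡ-+-* 2 (numEx B (minor g A (A ∪ B))) (exFrom g (A ∪ B) F)) ⟩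
    2 ^ exFrom g A (B ∷ F) ∎
    where open ≡-Reasoning

mainTheorem14 : (n : ℕ) (g : Op n) → IsConvexGeometry g →
    (F : List (Subset n)) → IsSetComposition F →
    (IsFlag g F → f φ' F g ≡ 2 ^ ex g F) × (¬ IsFlag g F → f φ' F g ≡ 0)
mainTheorem14 n g cg F (_ , F-disjoint , _) = flag , non-flag
  where
  open IsConvexGeometry cg
  flag : IsFlag g F → f φ' F g ≡ 2 ^ ex g F
  flag isFlag rewrite dec-true (prefixesConvexFrom? g ⊥ F) isFlag =
    prodFrom-φ' extensive monotone F (All.universal (λ Y → ∩-zeroˡ Y) F) F-disjoint
  non-flag : ¬ IsFlag g F → f φ' F g ≡ 0
  non-flag notFlag rewrite dec-false (prefixesConvexFrom? g ⊥ F) notFlag = refl
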